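{- Let $X_1,\dots,X_k$ be i.i.d. $\mathrm{PB}(p_1,\dots,p_n)$ random variables. Let $\mathcal{Z}$ be a finite set of independent Bernoulli random variables and, for each $j\in[k]$, let $\mathcal{Z}_j\subseteq\mathcal{Z}$ be such that $Y_j=\sum_{Z\in\mathcal{Z}_j}Z$ has distribution $\mathrm{PB}(p_1,\dots,p_n)$. Then $$\mathbb{E}\Big[\max_{j\in[k]}X_j\Big]\ge\mathbb{E}\Big[\max_{j\in[k]}Y_j\Big].$$
   Context: $\mathrm{PB}(p_1,\dots,p_n)$ is the Poisson binomial distribution: the law of a sum of independent Bernoulli variables with success probabilities $p_1,\dots,p_n$. -}

module Defs where

open import Level using (Level) renaming (suc to lsuc; _⊔_ to _⊔ˡ_)
open import Algebra.Bundles using (CommutativeRing)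
open import Relation.Binary.Core using (Rel)
open import Relation.Binary.Structures using (IsTotalOrder)
open import Relation.Nullary using (¬_)
open import Data.Product using (∃; _×_)
open import Data.Bool using (Bool; true; false; if_then_else_)
open import Data.Nat using (ℕ; zero; suc; _⊔_; _≡ᵇ_) renaming (_+_ to _+ℕ_)
open import Data.Fin using (Fin; toℕ)
open import Data.Fin.Subset using (Subset; inside; outside)
open import Data.Vec using (Vec; []; _∷_)
open import Data.List using (List; []; _∷_; map; concatMap; allFin)

-- Ordered fields (the stdlib has no reals; we work over an arbitrary
-- ordered field, of which ℝ is an instance).

record OrderedField (c ℓ₁ ℓ₂ : Level) : Set (lsuc (c ⊔ˡ ℓ₁ ⊔ˡ ℓ₂)) where
  field
    commutativeRing : CommutativeRing c ℓ₁
  open CommutativeRing commutativeRing public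
  infix 4 _≤_
  field
    _≤_          : Rel Carrier ℓ₂
    isTotalOrder : IsTotalOrder _≈_ _≤_
    +-mono-≤     : ∀ {a b} d → a ≤ b → a + d ≤ b + d
    *-nonneg     : ∀ {a b} → 0# ≤ a → 0# ≤ b → 0# ≤ a * b
    0≉1          : ¬ (0# ≈ 1#)
    inverse      : ∀ a → ¬ (a ≈ 0#) → ∃ λ b → a * b ≈ 1#

allVecs : ∀ {a} {A : Set a} → List A → (k : ℕ) → List (Vec A k)
allVecs xs zero    = [] ∷ []
allVecs xs (suc k) = concatMap (λ x → map (x ∷_) (allVecs xs k)) xs

countIn : ∀ {m} → Subset m → Vec Bool m → ℕ
countIn []            []         = 0
countIn (inside  ∷ S) (true ∷ ω) = suc (countIn S ω)
countIn (inside  ∷ S) (false ∷ ω) = countIn S ω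
countIn (outside ∷ S) (_ ∷ ω)    = countIn S ω

count : ∀ {m} → Vec Bool m → ℕ
count []           = 0
count (true ∷ ω)   = suc (count ω)
count (false ∷ ω)  = count ω

maxFin : ∀ {k} → (Fin k → ℕ) → ℕ
maxFin {zero}  f = 0
maxFin {suc k} f = f Data.Fin.zero ⊔ maxFin (λ j → f (Data.Fin.suc j))


maxVec : ∀ {k} → Vec ℕ k → ℕ
maxVec []       = 0
maxVec (x ∷ xs) = x ⊔ maxVec xs

module Prob {c ℓ₁ ℓ₂} (F : OrderedField c ℓ₁ ℓ₂) where
  open OrderedField F

  IsProb : Carrier → Set ℓ₂
  IsProb x = (0# ≤ x) × (x ≤ 1#)

  sumL : List Carrier → Carrier
  sumL []       = 0#
  sumL (x ∷ xs) = x + sumL xs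

  ι : ℕ → Carrier
  ι zero    = 0#
  ι (suc n) = 1# + ι n

  weight : ∀ {m} → Vec Carrier m → Vec Bool m → Carrier
  weight []       []          = 1#
  weight (q ∷ qs) (true ∷ ω)  = q * weight qs ω
  weight (q ∷ qs) (false ∷ ω) = (1# - q) * weight qs ω

  -- expectation of f(Z₁,…,Z_m), Z_i independent Bernoulli(q_i)
  expect : ∀ {m} → Vec Carrier m → (Vec Bool m → Carrier) → Carrier
  expect {m} q f = sumL (map (λ ω → weight q ω * f ω) (allVecs (true ∷ false ∷ []) m))

  indicator : Bool → Carrier
  indicator b = if b then 1# else 0#

  pbPmf : ∀ {n} → Vec Carrier n → ℕ → Carrier
  pbPmf p t = expect p (λ ω → indicator (count ω ≡ᵇ t))

  -- E[max_j X_j] for X₁,…,X_k i.i.d. PB(p₁,…,p_n)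
  expMaxIID : ∀ {n} → Vec Carrier n → (k : ℕ) → Carrier
  expMaxIID {n} p k =
    sumL (map (λ x → prodPmf x * ι (maxVec (Data.Vec.map toℕ x)))
              (allVecs (allFin (suc n)) k))
    where
    prodPmf : ∀ {k'} → Vec (Fin (suc n)) k' → Carrier
    prodPmf []       = 1#
    prodPmf (x ∷ xs) = pbPmf p (toℕ x) * prodPmf xs

  -- E[max_j Y_j] with Y_j = Σ_{i ∈ S_j} Z_i, Z_i independent Bernoulli(q_i)
  expMaxSubsets : ∀ {m k} → Vec Carrier m → (Fin k → Subset m) → Carrier
  expMaxSubsets q S = expect q (λ ω → ι (maxFin (λ j → countIn (S j) ω)))

  HasPBLaw : ∀ {m n} → Vec Carrier m → Subset m → Vec Carrier n → Set ℓ₁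
  HasPBLaw q S p = ∀ t → expect q (λ ω → indicator (countIn S ω ≡ᵇ t)) ≈ pbPmf p t

{-# OPTIONS --safe #-}
-- For a natural number M ≤ N we have M + #{t < N : M ≤ t} = N, hence
-- E[max] = N − Σ_{t<N} P(max ≤ t) on both sides, and it suffices to show
-- P(max_j Y_j ≤ t) ≥ P(max_j X_j ≤ t) = F(t)^k, with F the distribution
-- function of PB(p₁,…,p_n). Each event {Y_j ≤ t} is decreasing in the
-- underlying Bernoulli variables, so by the Harris inequality on the product
-- space P(∀ j. Y_j ≤ t) ≥ Π_j P(Y_j ≤ t) = F(t)^k. Harris' inequality is
-- proved one coordinate at a time; a single coordinate is Chebyshev's sum
-- inequality for a two-point distribution.
module Submission where

open import Defs
open import Level using (Level)
open import Function using (_∘_)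
open import Data.Bool using (Bool; true; false; T; _∧_; f≤t; b≤b) renaming (_≤_ to _≤ᴮ_)
open import Data.Bool.Properties using (∧-identityʳ) renaming (≤-refl to ≤ᴮ-refl)
open import Data.Nat using (ℕ; zero; suc; _⊔_; _≡ᵇ_; _≤ᵇ_; z≤n; s≤s)
  renaming (_≤_ to _≤ℕ_; _<_ to _<ℕ_; _+_ to _+ℕ_)
import Data.Nat.Properties as ℕ
open import Data.Fin using (Fin; toℕ) renaming (zero to fzero; suc to fsuc)
open import Data.Fin.Properties using (toℕ≤pred[n])
open import Data.Fin.Subset using (Subset; inside; outside)
open import Data.Vec using (Vec; []; _∷_; lookup)
import Data.Vec as Vec
open import Data.Vec.Relation.Unary.All using (All; []; _∷_)
open import Data.Vec.Relation.Binary.Pointwise.Inductive as Pointwise using (Pointwise; []; _∷_)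
open import Data.List using (List; []; _∷_; map; _++_; concatMap; allFin; tabulate)
open import Data.List.Properties using (map-++; map-∘; map-tabulate)
open import Data.Product using (_,_)
open import Data.Sum using (inj₁; inj₂)
open import Data.Empty using (⊥-elim)
open import Algebra.Bundles using (Semiring)
open import Relation.Binary.Bundles using (Poset)
open import Relation.Binary.Structures using (IsTotalOrder)
open import Relation.Binary.PropositionalEquality as ≡ using (_≡_)

module BernoulliMaxima {c ℓ₁ ℓ₂} (F : OrderedField c ℓ₁ ℓ₂) where
  open OrderedField F renaming (+-mono-≤ to +-monoˡ-≤)
  open Prob F
  open IsTotalOrder isTotalOrder using (total; isPartialOrder)
    renaming (refl to ≤-refl; trans to ≤-trans; reflexive to ≤-reflexive)
  open import Algebra.Properties.Ring ring
    using (-0#≈0#; -‿involutive; //-rightDividesˡ; //-rightDividesʳ; x[y-z]≈xy-xz; -1*x≈-x)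
  open import Algebra.Properties.CommutativeSemigroup +-commutativeSemigroup
    using () renaming (interchange to +-interchange)
  open import Algebra.Properties.CommutativeSemigroup *-commutativeSemigroup
    using () renaming (interchange to *-interchange)
  open import Algebra.Definitions.RawSemiring (Semiring.rawSemiring semiring) using (product; _^_)
  open import Algebra.Properties.Monoid.Sum *-monoid using ()
    renaming (sum-cong-≋ to product-cong; sum-replicate to product-const; sum-replicate-zero to product-1#)
  open import Algebra.Properties.CommutativeMonoid.Sum +-commutativeMonoid
    using (sum-syntax; sum-cong-≋; sum-replicate-zero; ∑-distrib-+)
  open import Algebra.Properties.Semiring.Sum semiring using (*-distribˡ-sum)
  open import Algebra.Properties.Semiring.Exp semiring using (^-congˡ)
  open import Algebra.Solver.Ring.NaturalCoefficients.Default commutativeSemiring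
    using (solve; _:=_; _:+_; _:*_)

  poset : Poset c ℓ₁ ℓ₂
  poset = record { isPartialOrder = isPartialOrder }

  open import Relation.Binary.Reasoning.PartialOrder poset

  private variable
    a : Level
    A : Set a

  -- Ordered ring arithmetic

  +-monoʳ-≤ : ∀ d {x y} → x ≤ y → d + x ≤ d + y
  +-monoʳ-≤ d {x} {y} x≤y = begin
    d + x  ≈⟨ +-comm d x ⟩
    x + d  ≤⟨ +-monoˡ-≤ d x≤y ⟩
    y + d  ≈⟨ +-comm y d ⟩
    d + y  ∎

  +-mono-≤ : ∀ {x y u v} → x ≤ y → u ≤ v → x + u ≤ y + v
  +-mono-≤ {y = y} {u} x≤y u≤v = ≤-trans (+-monoˡ-≤ u x≤y) (+-monoʳ-≤ y u≤v)

  +-nonneg : ∀ {x y} → 0# ≤ x → 0# ≤ y → 0# ≤ x + y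
  +-nonneg 0≤x 0≤y = ≤-trans (≤-reflexive (sym (+-identityʳ 0#))) (+-mono-≤ 0≤x 0≤y)

  x≤y⇒0≤y-x : ∀ {x y} → x ≤ y → 0# ≤ y - x
  x≤y⇒0≤y-x {x} {y} x≤y = begin
    0#     ≈⟨ -‿inverseʳ x ⟨
    x - x  ≤⟨ +-monoˡ-≤ (- x) x≤y ⟩
    y - x  ∎

  0≤y-x⇒x≤y : ∀ {x y} → 0# ≤ y - x → x ≤ y
  0≤y-x⇒x≤y {x} {y} 0≤y-x = begin
    x            ≈⟨ +-identityˡ x ⟨
    0# + x       ≤⟨ +-monoˡ-≤ x 0≤y-x ⟩
    (y - x) + x  ≈⟨ //-rightDividesˡ x y ⟩
    y            ∎

  x+u≈y+v⇒v≤u⇒x≤y : ∀ {x y u v} → x + u ≈ y + v → v ≤ u → x ≤ y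
  x+u≈y+v⇒v≤u⇒x≤y {x} {y} {u} {v} x+u≈y+v v≤u = begin
    x            ≈⟨ //-rightDividesʳ v x ⟨
    x + v - v    ≤⟨ +-monoˡ-≤ (- v) (+-monoʳ-≤ x v≤u) ⟩
    x + u - v    ≈⟨ +-congʳ x+u≈y+v ⟩
    y + v - v    ≈⟨ //-rightDividesʳ v y ⟩
    y            ∎

  neg-antimono-≤ : ∀ {x y} → x ≤ y → - y ≤ - x
  neg-antimono-≤ {x} {y} x≤y = 0≤y-x⇒x≤y (begin
    0#          ≤⟨ x≤y⇒0≤y-x x≤y ⟩
    y - x       ≈⟨ +-comm y (- x) ⟩
    - x + y     ≈⟨ +-congˡ (-‿involutive y) ⟨
    - x - - y   ∎)

  *-monoˡ-≤-nonNeg : ∀ {z x y} → 0# ≤ z → x ≤ y → z * x ≤ z * y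
  *-monoˡ-≤-nonNeg {z} {x} {y} 0≤z x≤y = 0≤y-x⇒x≤y (begin
    0#             ≤⟨ *-nonneg 0≤z (x≤y⇒0≤y-x x≤y) ⟩
    z * (y - x)    ≈⟨ x[y-z]≈xy-xz z y x ⟩
    z * y - z * x  ∎)

  *-monoʳ-≤-nonNeg : ∀ {z x y} → 0# ≤ z → x ≤ y → x * z ≤ y * z
  *-monoʳ-≤-nonNeg {z} {x} {y} 0≤z x≤y = begin
    x * z  ≈⟨ *-comm x z ⟩
    z * x  ≤⟨ *-monoˡ-≤-nonNeg 0≤z x≤y ⟩
    z * y  ≈⟨ *-comm z y ⟩
    y * z  ∎

  0≤1 : 0# ≤ 1#
  0≤1 with total 0# 1#
  ... | inj₁ 0≤1 = 0≤1
  ... | inj₂ 1≤0 = begin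
    0#              ≤⟨ *-nonneg 0≤-1 0≤-1 ⟩
    - 1# * - 1#     ≈⟨ -1*x≈-x (- 1#) ⟩
    - - 1#          ≈⟨ -‿involutive 1# ⟩
    1#              ∎
    where
    0≤-1 : 0# ≤ - 1#
    0≤-1 = ≤-trans (≤-reflexive (sym -0#≈0#)) (neg-antimono-≤ 1≤0)

  r+[1-r]≈1 : ∀ r → r + (1# - r) ≈ 1#
  r+[1-r]≈1 r = trans (+-comm r _) (//-rightDividesˡ r 1#)

  chebyshev-two-point : ∀ {r s a₀ a₁ b₀ b₁} → 0# ≤ r → 0# ≤ s → r + s ≈ 1# →
    a₁ ≤ a₀ → b₁ ≤ b₀ →
    (r * a₁ + s * a₀) * (r * b₁ + s * b₀) ≤ r * (a₁ * b₁) + s * (a₀ * b₀)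
  chebyshev-two-point {r} {s} {a₀} {a₁} {b₀} {b₁} 0≤r 0≤s r+s≈1 a₁≤a₀ b₁≤b₀ = begin
    (r * a₁ + s * a₀) * (r * b₁ + s * b₀)
      ≈⟨ *-cong (+-congˡ (*-congˡ a₀≈)) (+-congˡ (*-congˡ b₀≈)) ⟩
    X                                      ≈⟨ +-identityʳ X ⟨
    X + 0#                                 ≤⟨ +-monoʳ-≤ X 0≤rsuv ⟩
    X + r * s * (u * v)                    ≈⟨ identity ⟨
    (r + s) * Y                            ≈⟨ *-congʳ r+s≈1 ⟩
    1# * Y                                 ≈⟨ *-identityˡ Y ⟩
    Y                                      ≈⟨ +-congˡ (*-congˡ (*-cong a₀≈ b₀≈)) ⟨
    r * (a₁ * b₁) + s * (a₀ * b₀)          ∎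
    where
    u = a₀ - a₁
    v = b₀ - b₁
    a₀≈ : a₀ ≈ a₁ + u
    a₀≈ = trans (sym (//-rightDividesˡ a₁ a₀)) (+-comm u a₁)
    b₀≈ : b₀ ≈ b₁ + v
    b₀≈ = trans (sym (//-rightDividesˡ b₁ b₀)) (+-comm v b₁)
    0≤rsuv : 0# ≤ r * s * (u * v)
    0≤rsuv = *-nonneg (*-nonneg 0≤r 0≤s) (*-nonneg (x≤y⇒0≤y-x a₁≤a₀) (x≤y⇒0≤y-x b₁≤b₀))
    -- a₀ and b₀ are written as a₁ + u and b₁ + v so that the identity is
    -- subtraction-free, as the semiring solver requires.
    X = (r * a₁ + s * (a₁ + u)) * (r * b₁ + s * (b₁ + v))
    Y = r * (a₁ * b₁) + s * ((a₁ + u) * (b₁ + v))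
    identity : (r + s) * Y ≈ X + r * s * (u * v)
    identity = solve 6 (λ r s a₁ b₁ u v →
      (r :+ s) :* (r :* (a₁ :* b₁) :+ s :* ((a₁ :+ u) :* (b₁ :+ v))) :=
      (r :* a₁ :+ s :* (a₁ :+ u)) :* (r :* b₁ :+ s :* (b₁ :+ v)) :+ r :* s :* (u :* v))
      refl r s a₁ b₁ u v

  -- Finite sums and products

  ∑-mono-≤ : ∀ {N} {f g : Fin N → Carrier} → (∀ i → f i ≤ g i) → ∑[ i < N ] f i ≤ ∑[ i < N ] g i
  ∑-mono-≤ {zero}  f≤g = ≤-refl
  ∑-mono-≤ {suc N} f≤g = +-mono-≤ (f≤g fzero) (∑-mono-≤ (f≤g ∘ fsuc))

  product-nonneg : ∀ {k} {f : Fin k → Carrier} → (∀ j → 0# ≤ f j) → 0# ≤ product f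
  product-nonneg {zero}  0≤f = 0≤1
  product-nonneg {suc k} 0≤f = *-nonneg (0≤f fzero) (product-nonneg (0≤f ∘ fsuc))

  product-mono-≤ : ∀ {k} {f g : Fin k → Carrier} → (∀ j → 0# ≤ f j) → (∀ j → f j ≤ g j) →
    product f ≤ product g
  product-mono-≤ {zero}  0≤f f≤g = ≤-refl
  product-mono-≤ {suc k} {f} {g} 0≤f f≤g = begin
    f fzero * product (f ∘ fsuc)
      ≤⟨ *-monoˡ-≤-nonNeg (0≤f fzero) (product-mono-≤ (0≤f ∘ fsuc) (f≤g ∘ fsuc)) ⟩
    f fzero * product (g ∘ fsuc)  ≤⟨ *-monoʳ-≤-nonNeg 0≤∏g (f≤g fzero) ⟩
    g fzero * product (g ∘ fsuc)  ∎
    where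
    0≤∏g : 0# ≤ product (g ∘ fsuc)
    0≤∏g = product-nonneg (λ j → ≤-trans (0≤f (fsuc j)) (f≤g (fsuc j)))

  sumL-cong : ∀ (L : List A) {g h : A → Carrier} → (∀ x → g x ≈ h x) →
    sumL (map g L) ≈ sumL (map h L)
  sumL-cong []      g≈h = refl
  sumL-cong (x ∷ L) g≈h = +-cong (g≈h x) (sumL-cong L g≈h)

  sumL-+ : ∀ (L : List A) (g h : A → Carrier) →
    sumL (map (λ x → g x + h x) L) ≈ sumL (map g L) + sumL (map h L)
  sumL-+ []      g h = sym (+-identityʳ 0#)
  sumL-+ (x ∷ L) g h = trans (+-congˡ (sumL-+ L g h)) (+-interchange (g x) (h x) _ _)

  *-distribˡ-sumL : ∀ (L : List A) z (g : A → Carrier) →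
    z * sumL (map g L) ≈ sumL (map (λ x → z * g x) L)
  *-distribˡ-sumL []      z g = zeroʳ z
  *-distribˡ-sumL (x ∷ L) z g = trans (distribˡ z (g x) _) (+-congˡ (*-distribˡ-sumL L z g))

  sumL-∑ : ∀ (L : List A) N (h : Fin N → A → Carrier) →
    sumL (map (λ x → ∑[ t < N ] h t x) L) ≈ ∑[ t < N ] sumL (map (h t) L)
  sumL-∑ []      N h = sym (sum-replicate-zero N)
  sumL-∑ (x ∷ L) N h = trans (+-congˡ (sumL-∑ L N h)) (sym (∑-distrib-+ (λ t → h t x) _))

  sumL-++ : ∀ (xs ys : List Carrier) → sumL (xs ++ ys) ≈ sumL xs + sumL ys
  sumL-++ []       ys = sym (+-identityˡ _)
  sumL-++ (x ∷ xs) ys = trans (+-congˡ (sumL-++ xs ys)) (sym (+-assoc x _ _))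

  sumL-concatMap : ∀ {b} {B : Set b} (g : B → Carrier) (f : A → List B) (L : List A) →
    sumL (map g (concatMap f L)) ≈ sumL (map (λ x → sumL (map g (f x))) L)
  sumL-concatMap g f []      = refl
  sumL-concatMap g f (x ∷ L) = begin-equality
    sumL (map g (f x ++ concatMap f L))           ≡⟨ ≡.cong sumL (map-++ g (f x) _) ⟩
    sumL (map g (f x) ++ map g (concatMap f L))   ≈⟨ sumL-++ (map g (f x)) _ ⟩
    sumL (map g (f x)) + sumL (map g (concatMap f L))
                                                  ≈⟨ +-congˡ (sumL-concatMap g f L) ⟩
    sumL (map g (f x)) + sumL (map (λ y → sumL (map g (f y))) L)  ∎

  sumL-tabulate : ∀ {n} (f : Fin n → Carrier) → sumL (tabulate f) ≈ ∑[ i < n ] f i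
  sumL-tabulate {zero}  f = refl
  sumL-tabulate {suc n} f = +-congˡ (sumL-tabulate (f ∘ fsuc))

  -- Indicators, counts and maxima

  indicator-nonneg : ∀ b → 0# ≤ indicator b
  indicator-nonneg true  = 0≤1
  indicator-nonneg false = ≤-refl

  indicator-mono : ∀ {x y} → (T x → T y) → indicator x ≤ indicator y
  indicator-mono {false} {y}     _   = indicator-nonneg y
  indicator-mono {true}  {true}  _   = ≤-refl
  indicator-mono {true}  {false} x⇒y = ⊥-elim (x⇒y _)

  indicator-∧ : ∀ x y → indicator (x ∧ y) ≈ indicator x * indicator y
  indicator-∧ true  y = sym (*-identityˡ _)
  indicator-∧ false y = sym (zeroˡ _)

  ≤ᵇ-suc : ∀ m n → (suc m ≤ᵇ suc n) ≡ (m ≤ᵇ n)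
  ≤ᵇ-suc zero    n = ≡.refl
  ≤ᵇ-suc (suc m) n = ≡.refl

  ⊔-≤ᵇ : ∀ a b t → (a ⊔ b ≤ᵇ t) ≡ (a ≤ᵇ t) ∧ (b ≤ᵇ t)
  ⊔-≤ᵇ zero    b       t       = ≡.refl
  ⊔-≤ᵇ (suc a) zero    t       = ≡.sym (∧-identityʳ _)
  ⊔-≤ᵇ (suc a) (suc b) zero    = ≡.refl
  ⊔-≤ᵇ (suc a) (suc b) (suc t)
    rewrite ≤ᵇ-suc (a ⊔ b) t | ≤ᵇ-suc a t | ≤ᵇ-suc b t = ⊔-≤ᵇ a b t

  ≤ᵇ-antitone : ∀ {a b} t → a ≤ℕ b → T (b ≤ᵇ t) → T (a ≤ᵇ t)
  ≤ᵇ-antitone {a} {b} t a≤b b≤t = ℕ.≤⇒≤ᵇ (ℕ.≤-trans a≤b (ℕ.≤ᵇ⇒≤ b t b≤t))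

  indicator-maxFin-≤ᵇ : ∀ {k} (f : Fin k → ℕ) t →
    indicator (maxFin f ≤ᵇ t) ≈ product (λ j → indicator (f j ≤ᵇ t))
  indicator-maxFin-≤ᵇ {zero}  f t = refl
  indicator-maxFin-≤ᵇ {suc k} f t = begin-equality
    indicator (f fzero ⊔ maxFin (f ∘ fsuc) ≤ᵇ t)
      ≡⟨ ≡.cong indicator (⊔-≤ᵇ (f fzero) _ t) ⟩
    indicator ((f fzero ≤ᵇ t) ∧ (maxFin (f ∘ fsuc) ≤ᵇ t))
      ≈⟨ indicator-∧ _ _ ⟩
    indicator (f fzero ≤ᵇ t) * indicator (maxFin (f ∘ fsuc) ≤ᵇ t)
      ≈⟨ *-congˡ (indicator-maxFin-≤ᵇ (f ∘ fsuc) t) ⟩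
    indicator (f fzero ≤ᵇ t) * product (λ j → indicator (f (fsuc j) ≤ᵇ t)) ∎

  ∑-1≈ι : ∀ N → ∑[ t < N ] 1# ≈ ι N
  ∑-1≈ι zero    = refl
  ∑-1≈ι (suc N) = +-congˡ (∑-1≈ι N)

  ι+∑[≤t]≈ι : ∀ {M N} → M ≤ℕ N → ι M + ∑[ t < N ] indicator (M ≤ᵇ toℕ t) ≈ ι N
  ι+∑[≤t]≈ι {N = N} z≤n = trans (+-identityˡ _) (∑-1≈ι N)
  ι+∑[≤t]≈ι {suc M} {suc N} (s≤s M≤N) = begin-equality
    (1# + ι M) + (0# + ∑[ t < N ] indicator (suc M ≤ᵇ suc (toℕ t)))
      ≈⟨ +-congˡ (trans (+-identityˡ _)
                        (sum-cong-≋ {N} λ t → reflexive (≡.cong indicator (≤ᵇ-suc M (toℕ t))))) ⟩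
    (1# + ι M) + ∑[ t < N ] indicator (M ≤ᵇ toℕ t)  ≈⟨ +-assoc 1# (ι M) _ ⟩
    1# + (ι M + ∑[ t < N ] indicator (M ≤ᵇ toℕ t))  ≈⟨ +-congˡ (ι+∑[≤t]≈ι M≤N) ⟩
    1# + ι N                                         ∎

  ∑-indicator-≡ᵇ : ∀ {a} c → c <ℕ a → (g : ℕ → Carrier) →
    ∑[ s < a ] (indicator (c ≡ᵇ toℕ s) * g (toℕ s)) ≈ g c
  ∑-indicator-≡ᵇ {suc a} zero    _         g = begin-equality
    1# * g 0 + ∑[ s < a ] (0# * g (suc (toℕ s)))
      ≈⟨ +-cong (*-identityˡ (g 0)) (trans (sum-cong-≋ {a} (λ s → zeroˡ _)) (sum-replicate-zero a)) ⟩
    g 0 + 0#  ≈⟨ +-identityʳ (g 0) ⟩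
    g 0       ∎
  ∑-indicator-≡ᵇ {suc a} (suc c) (s≤s c<a) g =
    trans (+-cong (zeroˡ (g 0)) (∑-indicator-≡ᵇ c c<a (g ∘ suc))) (+-identityˡ _)

  maxFin-lub : ∀ {k} {f : Fin k → ℕ} {B} → (∀ j → f j ≤ℕ B) → maxFin f ≤ℕ B
  maxFin-lub {zero}  f≤B = z≤n
  maxFin-lub {suc k} f≤B = ℕ.⊔-lub (f≤B fzero) (maxFin-lub (f≤B ∘ fsuc))

  maxVec-map : ∀ {k} {B : Set} (f : B → ℕ) (xs : Vec B k) → maxVec (Vec.map f xs) ≡ maxFin (f ∘ lookup xs)
  maxVec-map f []       = ≡.refl
  maxVec-map f (x ∷ xs) = ≡.cong (f x ⊔_) (maxVec-map f xs)

  count-≤ : ∀ {n} (ω : Vec Bool n) → count ω ≤ℕ n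
  count-≤ []          = z≤n
  count-≤ (true ∷ ω)  = s≤s (count-≤ ω)
  count-≤ (false ∷ ω) = ℕ.m≤n⇒m≤1+n (count-≤ ω)

  countIn-≤ : ∀ {m} (S : Subset m) (ω : Vec Bool m) → countIn S ω ≤ℕ m
  countIn-≤ []            []          = z≤n
  countIn-≤ (inside  ∷ S) (true ∷ ω)  = s≤s (countIn-≤ S ω)
  countIn-≤ (inside  ∷ S) (false ∷ ω) = ℕ.m≤n⇒m≤1+n (countIn-≤ S ω)
  countIn-≤ (outside ∷ S) (_ ∷ ω)     = ℕ.m≤n⇒m≤1+n (countIn-≤ S ω)

  countIn-mono : ∀ {m} (S : Subset m) {ω ω′} → Pointwise _≤ᴮ_ ω ω′ → countIn S ω ≤ℕ countIn S ω′
  countIn-mono []            []                 = z≤n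
  countIn-mono (inside  ∷ S) (b≤b {true}  ∷ ω≤) = s≤s (countIn-mono S ω≤)
  countIn-mono (inside  ∷ S) (b≤b {false} ∷ ω≤) = countIn-mono S ω≤
  countIn-mono (inside  ∷ S) (f≤t ∷ ω≤)         = ℕ.m≤n⇒m≤1+n (countIn-mono S ω≤)
  countIn-mono (outside ∷ S) (_ ∷ ω≤)           = countIn-mono S ω≤

  -- Expectations over finite weighted lists

  expectOver : List A → (A → Carrier) → (A → Carrier) → Carrier
  expectOver L w f = sumL (map (λ x → w x * f x) L)

  expectOver-cong : ∀ (L : List A) w {f g} → (∀ x → f x ≈ g x) → expectOver L w f ≈ expectOver L w g
  expectOver-cong L w f≈g = sumL-cong L (λ x → *-congˡ (f≈g x))

  expectOver-mono : ∀ (L : List A) {w f g} → (∀ x → 0# ≤ w x) → (∀ x → f x ≤ g x) →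
    expectOver L w f ≤ expectOver L w g
  expectOver-mono []      0≤w f≤g = ≤-refl
  expectOver-mono (x ∷ L) 0≤w f≤g =
    +-mono-≤ (*-monoˡ-≤-nonNeg (0≤w x) (f≤g x)) (expectOver-mono L 0≤w f≤g)

  expectOver-nonneg : ∀ (L : List A) {w f} → (∀ x → 0# ≤ w x) → (∀ x → 0# ≤ f x) →
    0# ≤ expectOver L w f
  expectOver-nonneg []      0≤w 0≤f = ≤-refl
  expectOver-nonneg (x ∷ L) 0≤w 0≤f =
    +-nonneg (*-nonneg (0≤w x) (0≤f x)) (expectOver-nonneg L 0≤w 0≤f)

  expectOver-+ : ∀ (L : List A) w f g →
    expectOver L w (λ x → f x + g x) ≈ expectOver L w f + expectOver L w g
  expectOver-+ L w f g = trans (sumL-cong L (λ x → distribˡ (w x) (f x) (g x))) (sumL-+ L _ _)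

  expectOver-*ʳ : ∀ (L : List A) w f z → expectOver L w (λ x → f x * z) ≈ expectOver L w f * z
  expectOver-*ʳ L w f z = begin-equality
    expectOver L w (λ x → f x * z)
      ≈⟨ sumL-cong L (λ x → trans (sym (*-assoc (w x) (f x) z)) (*-comm _ z)) ⟩
    sumL (map (λ x → z * (w x * f x)) L) ≈⟨ *-distribˡ-sumL L z _ ⟨
    z * expectOver L w f               ≈⟨ *-comm z _ ⟩
    expectOver L w f * z               ∎

  expectOver-scaleʷ : ∀ (L : List A) z w f → expectOver L (λ x → z * w x) f ≈ z * expectOver L w f
  expectOver-scaleʷ L z w f =
    trans (sumL-cong L (λ x → *-assoc z (w x) (f x))) (sym (*-distribˡ-sumL L z _))

  expectOver-∑ : ∀ (L : List A) w N (h : Fin N → A → Carrier) →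
    expectOver L w (λ x → ∑[ t < N ] h t x) ≈ ∑[ t < N ] expectOver L w (h t)
  expectOver-∑ L w N h = begin-equality
    expectOver L w (λ x → ∑[ t < N ] h t x)        ≈⟨ sumL-cong L (λ x → *-distribˡ-sum (w x) (λ t → h t x)) ⟩
    sumL (map (λ x → ∑[ t < N ] (w x * h t x)) L)  ≈⟨ sumL-∑ L N (λ t x → w x * h t x) ⟩
    ∑[ t < N ] expectOver L w (h t)                ∎

  expectOver-ι+∑[≤t] : ∀ (L : List A) {w} (X : A → ℕ) {N} → expectOver L w (λ _ → 1#) ≈ 1# →
    (∀ x → X x ≤ℕ N) →
    expectOver L w (ι ∘ X) + ∑[ t < N ] expectOver L w (λ x → indicator (X x ≤ᵇ toℕ t)) ≈ ι N
  expectOver-ι+∑[≤t] L {w} X {N} mass X≤N = begin-equality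
    expectOver L w (ι ∘ X) + ∑[ t < N ] expectOver L w (λ x → indicator (X x ≤ᵇ toℕ t))
      ≈⟨ +-congˡ (expectOver-∑ L w N _) ⟨
    expectOver L w (ι ∘ X) + expectOver L w (λ x → ∑[ t < N ] indicator (X x ≤ᵇ toℕ t))
      ≈⟨ expectOver-+ L w _ _ ⟨
    expectOver L w (λ x → ι (X x) + ∑[ t < N ] indicator (X x ≤ᵇ toℕ t))
      ≈⟨ expectOver-cong L w (λ x → trans (ι+∑[≤t]≈ι (X≤N x)) (sym (*-identityˡ (ι N)))) ⟩
    expectOver L w (λ _ → 1# * ι N)  ≈⟨ expectOver-*ʳ L w _ (ι N) ⟩
    expectOver L w (λ _ → 1#) * ι N  ≈⟨ *-congʳ mass ⟩
    1# * ι N                         ≈⟨ *-identityˡ (ι N) ⟩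
    ι N                              ∎

  expectOver-∘-pmf : ∀ (L : List A) w (X : A → ℕ) {a} → (∀ x → X x <ℕ a) → (g : ℕ → Carrier) →
    expectOver L w (g ∘ X) ≈ ∑[ s < a ] (expectOver L w (λ x → indicator (X x ≡ᵇ toℕ s)) * g (toℕ s))
  expectOver-∘-pmf L w X {a} X<a g = begin-equality
    expectOver L w (g ∘ X)
      ≈⟨ expectOver-cong L w (λ x → ∑-indicator-≡ᵇ (X x) (X<a x) g) ⟨
    expectOver L w (λ x → ∑[ s < a ] (indicator (X x ≡ᵇ toℕ s) * g (toℕ s)))
      ≈⟨ expectOver-∑ L w a _ ⟩
    ∑[ s < a ] expectOver L w (λ x → indicator (X x ≡ᵇ toℕ s) * g (toℕ s))
      ≈⟨ sum-cong-≋ {a} (λ s → expectOver-*ʳ L w _ (g (toℕ s))) ⟩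
    ∑[ s < a ] (expectOver L w (λ x → indicator (X x ≡ᵇ toℕ s)) * g (toℕ s)) ∎

  expectOver-allVecs-suc : ∀ (L : List A) k w f →
    expectOver (allVecs L (suc k)) w f ≈
    sumL (map (λ x → expectOver (allVecs L k) (w ∘ (x ∷_)) (f ∘ (x ∷_))) L)
  expectOver-allVecs-suc L k w f = trans
    (sumL-concatMap (λ xs → w xs * f xs) (λ x → map (x ∷_) (allVecs L k)) L)
    (sumL-cong L (λ x → reflexive (≡.cong sumL (≡.sym (map-∘ (allVecs L k))))))

  expectOver-allVecs-product : ∀ {A : Set a} (L : List A) (pm g : A → Carrier)
    (Pr : ∀ {j} → Vec A j → Carrier) → Pr [] ≈ 1# → (∀ {j} x (xs : Vec A j) → Pr (x ∷ xs) ≈ pm x * Pr xs) →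
    ∀ k → expectOver (allVecs L k) Pr (λ xs → product (λ i → g (lookup xs i))) ≈ expectOver L pm g ^ k
  expectOver-allVecs-product L pm g Pr Pr[] Pr∷ zero =
    trans (+-identityʳ _) (trans (*-identityʳ _) Pr[])
  expectOver-allVecs-product {A = A} L pm g Pr Pr[] Pr∷ (suc k) = begin-equality
    expectOver (allVecs L (suc k)) Pr G                            ≈⟨ expectOver-allVecs-suc L k Pr G ⟩
    sumL (map (λ x → expectOver V (Pr ∘ (x ∷_)) (G ∘ (x ∷_))) L)  ≈⟨ sumL-cong L factor ⟩
    expectOver L pm (λ x → g x * μ ^ k)                            ≈⟨ expectOver-*ʳ L pm g (μ ^ k) ⟩
    μ * μ ^ k                                                      ∎
    where
    V = allVecs L k
    μ = expectOver L pm g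
    G : ∀ {j} → Vec A j → Carrier
    G xs = product (λ i → g (lookup xs i))
    factor : ∀ x → expectOver V (Pr ∘ (x ∷_)) (G ∘ (x ∷_)) ≈ pm x * (g x * μ ^ k)
    factor x = begin-equality
      sumL (map (λ xs → Pr (x ∷ xs) * (g x * G xs)) V)
        ≈⟨ sumL-cong V (λ xs → trans (*-congʳ (Pr∷ x xs)) (*-interchange (pm x) (Pr xs) (g x) (G xs))) ⟩
      sumL (map (λ xs → pm x * g x * (Pr xs * G xs)) V)
        ≈⟨ *-distribˡ-sumL V (pm x * g x) _ ⟨
      pm x * g x * expectOver V Pr G
        ≈⟨ *-congˡ (expectOver-allVecs-product L pm g Pr Pr[] Pr∷ k) ⟩
      pm x * g x * μ ^ k
        ≈⟨ *-assoc (pm x) (g x) (μ ^ k) ⟩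
      pm x * (g x * μ ^ k) ∎

  -- Independent Bernoulli variables and Harris' inequality

  outcomes : ∀ m → List (Vec Bool m)
  outcomes = allVecs (true ∷ false ∷ [])

  weight-nonneg : ∀ {m} {q : Vec Carrier m} → All IsProb q → ∀ ω → 0# ≤ weight q ω
  weight-nonneg []                      []          = 0≤1
  weight-nonneg ((0≤r , _)   ∷ q-prob) (true ∷ ω)  = *-nonneg 0≤r (weight-nonneg q-prob ω)
  weight-nonneg ((_   , r≤1) ∷ q-prob) (false ∷ ω) = *-nonneg (x≤y⇒0≤y-x r≤1) (weight-nonneg q-prob ω)

  expect-cong : ∀ {m} (q : Vec Carrier m) {f g} → (∀ ω → f ω ≈ g ω) → expect q f ≈ expect q g
  expect-cong {m} q = expectOver-cong (outcomes m) (weight q)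

  expect-mono : ∀ {m} {q : Vec Carrier m} → All IsProb q → ∀ {f g} → (∀ ω → f ω ≤ g ω) →
    expect q f ≤ expect q g
  expect-mono {m} q-prob = expectOver-mono (outcomes m) (weight-nonneg q-prob)

  expect-nonneg : ∀ {m} {q : Vec Carrier m} → All IsProb q → ∀ {f} → (∀ ω → 0# ≤ f ω) →
    0# ≤ expect q f
  expect-nonneg {m} q-prob = expectOver-nonneg (outcomes m) (weight-nonneg q-prob)

  expect-[] : ∀ f → expect [] f ≈ f []
  expect-[] f = trans (+-identityʳ _) (*-identityˡ _)

  expect-∷ : ∀ {m} r (q : Vec Carrier m) f →
    expect (r ∷ q) f ≈ r * expect q (f ∘ (true ∷_)) + (1# - r) * expect q (f ∘ (false ∷_))
  expect-∷ {m} r q f = trans (expectOver-allVecs-suc (true ∷ false ∷ []) m (weight (r ∷ q)) f)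
    (+-cong (expectOver-scaleʷ (outcomes m) r (weight q) _)
            (trans (+-identityʳ _) (expectOver-scaleʷ (outcomes m) (1# - r) (weight q) _)))

  expect-1 : ∀ {m} (q : Vec Carrier m) → expect q (λ _ → 1#) ≈ 1#
  expect-1 []      = expect-[] (λ _ → 1#)
  expect-1 (r ∷ q) = begin-equality
    expect (r ∷ q) (λ _ → 1#)                           ≈⟨ expect-∷ r q _ ⟩
    r * expect q (λ _ → 1#) + (1# - r) * expect q (λ _ → 1#)
                                                        ≈⟨ +-cong (*-congˡ (expect-1 q)) (*-congˡ (expect-1 q)) ⟩
    r * 1# + (1# - r) * 1#                              ≈⟨ +-cong (*-identityʳ r) (*-identityʳ _) ⟩
    r + (1# - r)                                        ≈⟨ r+[1-r]≈1 r ⟩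
    1#                                                  ∎

  Decreasing : ∀ {m} → (Vec Bool m → Carrier) → Set ℓ₂
  Decreasing f = ∀ {ω ω′} → Pointwise _≤ᴮ_ ω ω′ → f ω′ ≤ f ω

  harris : ∀ {m} {q : Vec Carrier m} → All IsProb q → ∀ {f g} → Decreasing f → Decreasing g →
    expect q f * expect q g ≤ expect q (λ ω → f ω * g ω)
  harris [] {f} {g} _ _ = ≤-reflexive (begin-equality
    expect [] f * expect [] g    ≈⟨ *-cong (expect-[] f) (expect-[] g) ⟩
    f [] * g []                  ≈⟨ expect-[] (λ ω → f ω * g ω) ⟨
    expect [] (λ ω → f ω * g ω)  ∎)
  harris {q = r ∷ q} ((0≤r , r≤1) ∷ q-prob) {f} {g} f↓ g↓ = begin
    expect (r ∷ q) f * expect (r ∷ q) g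
      ≈⟨ *-cong (expect-∷ r q f) (expect-∷ r q g) ⟩
    (r * E f₁ + (1# - r) * E f₀) * (r * E g₁ + (1# - r) * E g₀)
      ≤⟨ chebyshev-two-point 0≤r 0≤1-r (r+[1-r]≈1 r) (E-true≤E-false f↓) (E-true≤E-false g↓) ⟩
    r * (E f₁ * E g₁) + (1# - r) * (E f₀ * E g₀)
      ≤⟨ +-mono-≤ (*-monoˡ-≤-nonNeg 0≤r (harris q-prob (restrict f↓) (restrict g↓)))
                  (*-monoˡ-≤-nonNeg 0≤1-r (harris q-prob (restrict f↓) (restrict g↓))) ⟩
    r * E (λ ω → f₁ ω * g₁ ω) + (1# - r) * E (λ ω → f₀ ω * g₀ ω)
      ≈⟨ expect-∷ r q _ ⟨
    expect (r ∷ q) (λ ω → f ω * g ω) ∎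
    where
    E = expect q
    f₁ = f ∘ (true ∷_)
    f₀ = f ∘ (false ∷_)
    g₁ = g ∘ (true ∷_)
    g₀ = g ∘ (false ∷_)
    0≤1-r : 0# ≤ 1# - r
    0≤1-r = x≤y⇒0≤y-x r≤1
    restrict : ∀ {h b} → Decreasing h → Decreasing (h ∘ (b ∷_))
    restrict h↓ ω≤ω′ = h↓ (≤ᴮ-refl ∷ ω≤ω′)
    E-true≤E-false : ∀ {h} → Decreasing h → E (h ∘ (true ∷_)) ≤ E (h ∘ (false ∷_))
    E-true≤E-false h↓ = expect-mono q-prob (λ ω → h↓ (f≤t ∷ Pointwise.refl ≤ᴮ-refl))

  harris-product : ∀ {m k} {q : Vec Carrier m} → All IsProb q → (f : Fin k → Vec Bool m → Carrier) →
    (∀ j ω → 0# ≤ f j ω) → (∀ j → Decreasing (f j)) →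
    product (λ j → expect q (f j)) ≤ expect q (λ ω → product (λ j → f j ω))
  harris-product {k = zero} {q} _ f _ _ = ≤-reflexive (sym (expect-1 q))
  harris-product {k = suc k} {q} q-prob f 0≤f f↓ = begin
    expect q (f fzero) * product (λ j → expect q (f (fsuc j)))
      ≤⟨ *-monoˡ-≤-nonNeg (expect-nonneg q-prob (0≤f fzero))
                          (harris-product q-prob (f ∘ fsuc) (0≤f ∘ fsuc) (f↓ ∘ fsuc)) ⟩
    expect q (f fzero) * expect q (λ ω → product (λ j → f (fsuc j) ω))
      ≤⟨ harris q-prob (f↓ fzero)
           (λ ω≤ω′ → product-mono-≤ (λ j → 0≤f (fsuc j) _) (λ j → f↓ (fsuc j) ω≤ω′)) ⟩
    expect q (λ ω → product (λ j → f j ω)) ∎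

  -- Comparison of the two maxima

  pbCdf : ∀ {n} → Vec Carrier n → ℕ → Carrier
  pbCdf p t = expect p (λ ω → indicator (count ω ≤ᵇ t))

  HasPBLaw⇒expect-countIn≈expect-count : ∀ {m n} {q : Vec Carrier m} {S : Subset m} {p : Vec Carrier n} →
    HasPBLaw q S p → ∀ g → expect q (g ∘ countIn S) ≈ expect p (g ∘ count)
  HasPBLaw⇒expect-countIn≈expect-count {m} {n} {q} {S} {p} law g = begin-equality
    expect q (g ∘ countIn S)
      ≈⟨ expectOver-∘-pmf (outcomes m) (weight q) (countIn S)
           (λ ω → s≤s (ℕ.≤-trans (countIn-≤ S ω) (ℕ.m≤m+n m n))) g ⟩
    ∑[ s < R ] (expect q (λ ω → indicator (countIn S ω ≡ᵇ toℕ s)) * g (toℕ s))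
      ≈⟨ sum-cong-≋ {R} (λ s → *-congʳ {g (toℕ s)} (law (toℕ s))) ⟩
    ∑[ s < R ] (pbPmf p (toℕ s) * g (toℕ s))
      ≈⟨ expectOver-∘-pmf (outcomes n) (weight p) count
           (λ ω → s≤s (ℕ.≤-trans (count-≤ ω) (ℕ.m≤n+m n m))) g ⟨
    expect p (g ∘ count) ∎
    where R = suc (m +ℕ n)

  expectOver-allFin-pbPmf : ∀ {n} (p : Vec Carrier n) (g : ℕ → Carrier) →
    expectOver (allFin (suc n)) (pbPmf p ∘ toℕ) (g ∘ toℕ) ≈ expect p (g ∘ count)
  expectOver-allFin-pbPmf {n} p g = begin-equality
    sumL (map h (allFin (suc n)))   ≡⟨ ≡.cong sumL (map-tabulate (λ i → i) h) ⟩
    sumL (tabulate h)               ≈⟨ sumL-tabulate h ⟩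
    ∑[ s < suc n ] h s
      ≈⟨ expectOver-∘-pmf (outcomes n) (weight p) count (λ ω → s≤s (count-≤ ω)) g ⟨
    expect p (g ∘ count)            ∎
    where
    h : Fin (suc n) → Carrier
    h s = pbPmf p (toℕ s) * g (toℕ s)

  -- The weight prodPmf is local to expMaxIID, so it enters here through its
  -- defining equations and is recovered by unification in expMaxIID+∑pbCdf^k;
  -- the solution is unique only because k is quantified after Pr.
  iid-ι∘max+∑pbCdf^k : ∀ {n} (p : Vec Carrier n) (Pr : ∀ {j} → Vec (Fin (suc n)) j → Carrier) →
    Pr [] ≈ 1# → (∀ {j} x (xs : Vec (Fin (suc n)) j) → Pr (x ∷ xs) ≈ pbPmf p (toℕ x) * Pr xs) →
    ∀ k {N} → n ≤ℕ N →
    expectOver (allVecs (allFin (suc n)) k) Pr (λ xs → ι (maxVec (Vec.map toℕ xs))) +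
    ∑[ t < N ] (pbCdf p (toℕ t) ^ k) ≈ ι N
  iid-ι∘max+∑pbCdf^k {n} p Pr Pr[] Pr∷ k {N} n≤N = begin-equality
    E (ι ∘ maxX) + ∑[ t < N ] (pbCdf p (toℕ t) ^ k)
      ≈⟨ +-congˡ (sum-cong-≋ {N} P[maxX≤t]) ⟨
    E (ι ∘ maxX) + ∑[ t < N ] E (λ xs → indicator (maxX xs ≤ᵇ toℕ t))
      ≈⟨ expectOver-ι+∑[≤t] V maxX mass maxX≤N ⟩
    ι N ∎
    where
    V = allVecs (allFin (suc n)) k
    E = expectOver V Pr
    maxX : Vec (Fin (suc n)) k → ℕ
    maxX xs = maxVec (Vec.map toℕ xs)
    factorise : ∀ g → E (λ xs → product (λ i → g (toℕ (lookup xs i)))) ≈ expect p (g ∘ count) ^ k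
    factorise g = trans
      (expectOver-allVecs-product (allFin (suc n)) (pbPmf p ∘ toℕ) (g ∘ toℕ) Pr Pr[] Pr∷ k)
      (^-congˡ k (expectOver-allFin-pbPmf p g))
    mass : E (λ _ → 1#) ≈ 1#
    mass = begin-equality
      E (λ _ → 1#)                      ≈⟨ expectOver-cong V Pr {g = λ _ → 1#} (λ _ → product-1# k) ⟨
      E (λ _ → product {k} (λ _ → 1#))  ≈⟨ factorise (λ _ → 1#) ⟩
      expect p (λ _ → 1#) ^ k           ≈⟨ ^-congˡ k (expect-1 p) ⟩
      1# ^ k                            ≈⟨ product-const k ⟨
      product {k} (λ _ → 1#)            ≈⟨ product-1# k ⟩
      1#                                ∎
    P[maxX≤t] : ∀ t → E (λ xs → indicator (maxX xs ≤ᵇ toℕ t)) ≈ pbCdf p (toℕ t) ^ k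
    P[maxX≤t] t = trans (expectOver-cong V Pr indicator-maxX≤t) (factorise (λ s → indicator (s ≤ᵇ toℕ t)))
      where
      indicator-maxX≤t : ∀ xs → indicator (maxX xs ≤ᵇ toℕ t) ≈ product (λ i → indicator (toℕ (lookup xs i) ≤ᵇ toℕ t))
      indicator-maxX≤t xs = trans (reflexive (≡.cong (λ M → indicator (M ≤ᵇ toℕ t)) (maxVec-map toℕ xs)))
                           (indicator-maxFin-≤ᵇ (toℕ ∘ lookup xs) (toℕ t))
    maxX≤N : ∀ xs → maxX xs ≤ℕ N
    maxX≤N xs = ≡.subst (_≤ℕ N) (≡.sym (maxVec-map toℕ xs))
                        (maxFin-lub (λ i → ℕ.≤-trans (toℕ≤pred[n] (lookup xs i)) n≤N))

  expMaxIID+∑pbCdf^k : ∀ {n} (p : Vec Carrier n) k {N} → n ≤ℕ N →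
    expMaxIID p k + ∑[ t < N ] (pbCdf p (toℕ t) ^ k) ≈ ι N
  expMaxIID+∑pbCdf^k p = iid-ι∘max+∑pbCdf^k p _ refl (λ _ _ → refl)

  pbCdf^k≤P[maxY≤t] : ∀ {n m k} {p : Vec Carrier n} {q : Vec Carrier m} {S : Fin k → Subset m} →
    All IsProb q → (∀ j → HasPBLaw q (S j) p) → ∀ t →
    pbCdf p t ^ k ≤ expect q (λ ω → indicator (maxFin (λ j → countIn (S j) ω) ≤ᵇ t))
  pbCdf^k≤P[maxY≤t] {k = k} {p} {q} {S} q-prob laws t = begin
    pbCdf p t ^ k
      ≈⟨ product-const k ⟨
    product {k} (λ _ → pbCdf p t)
      ≈⟨ product-cong {k} (λ j → HasPBLaw⇒expect-countIn≈expect-count {q = q} {S j} {p} (laws j)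
                                                                         (λ s → indicator (s ≤ᵇ t))) ⟨
    product (λ j → expect q (λ ω → indicator (countIn (S j) ω ≤ᵇ t)))
      ≤⟨ harris-product q-prob (λ j ω → indicator (countIn (S j) ω ≤ᵇ t)) (λ j ω → indicator-nonneg _)
           (λ j ω≤ω′ → indicator-mono (≤ᵇ-antitone t (countIn-mono (S j) ω≤ω′))) ⟩
    expect q (λ ω → product (λ j → indicator (countIn (S j) ω ≤ᵇ t)))
      ≈⟨ expect-cong q (λ ω → indicator-maxFin-≤ᵇ (λ j → countIn (S j) ω) t) ⟨
    expect q (λ ω → indicator (maxFin (λ j → countIn (S j) ω) ≤ᵇ t)) ∎

lemmaA12 : ∀ {c ℓ₁ ℓ₂ : Level} (F : OrderedField c ℓ₁ ℓ₂) →
    let open OrderedField F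
        open Prob F
    in (n k m : ℕ) (p : Vec Carrier n) → All IsProb p →
       (q : Vec Carrier m) → All IsProb q →
       (S : Fin k → Subset m) → (∀ j → HasPBLaw q (S j) p) →
       expMaxSubsets q S ≤ expMaxIID p k
-- The i.i.d. side is an algebraic identity, valid for arbitrary p.
lemmaA12 F n k m p _ q q-prob S laws =
  x+u≈y+v⇒v≤u⇒x≤y
    (trans (expectOver-ι+∑[≤t] (outcomes m) maxY (expect-1 q) maxY≤n+m)
           (sym (expMaxIID+∑pbCdf^k p k (ℕ.m≤m+n n m))))
    (∑-mono-≤ {n +ℕ m} (λ t → pbCdf^k≤P[maxY≤t] {p = p} {S = S} q-prob laws (toℕ t)))
  where
  open OrderedField F using (trans; sym)
  open BernoulliMaxima F
  maxY : Vec Bool m → ℕ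
  maxY ω = maxFin (λ j → countIn (S j) ω)
  maxY≤n+m : ∀ ω → maxY ω ≤ℕ n +ℕ m
  maxY≤n+m ω = maxFin-lub (λ j → ℕ.≤-trans (countIn-≤ (S j) ω) (ℕ.m≤n+m m n))
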